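{- Let $G=(V,E)$ be a connected chordal claw-free graph with clique tree $T_G=(\mathcal M,\mathcal E)$ and let $z\in V$. If a max clique $B\in\mathcal M_z$ has a fork triangle, then $|\mathcal M_z|=3$ and $B$ is the middle vertex of the path $T_G[\mathcal M_z]$.
   Context: Graphs are finite simple undirected. A graph is chordal if every cycle of length at least 4 has a chord, and claw-free if it has no induced $K_{1,3}$. A max clique is an inclusion-maximal clique; $\mathcal M$ is the set of max cliques and $\mathcal M_v$ the set of max cliques containing $v$. A clique tree is a tree on $\mathcal M$ in which each $T[\mathcal M_v]$ is connected; a connected chordal claw-free graph has exactly one clique tree $T_G$, and each $T_G[\mathcal M_v]$ is a path. Max cliques $A_1,A_2,A_3$ form a fork triangle around $B$ if they are distinct neighbours of $B$ in $T_G$ and there are $u,v,w\in V$ with $\mathcal M_u=\{A_1,B,A_2\}$, $\mathcal M_v=\{A_2,B,A_3\}$, $\mathcal M_w=\{A_3,B,A_1\}$; $B$ has a fork triangle if some such $A_1,A_2,A_3$ exist. -}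

module Defs where

open import Data.Nat using (ℕ; zero; suc; _≤_; _≥_)
open import Data.Fin using (Fin; zero; suc; toℕ; inject₁; fromℕ)
open import Data.Fin.Subset using (Subset; _∈_; _⊆_)
open import Data.Product using (Σ; ∃; ∃-syntax; _×_; _,_)
open import Data.Sum using (_⊎_)
open import Data.Unit using (⊤)
open import Data.Empty using (⊥)
open import Function.Definitions using (Injective)
open import Relation.Nullary using (¬_)
open import Relation.Binary using (Decidable)
open import Relation.Binary.PropositionalEquality using (_≡_; _≢_)

record Graph (n : ℕ) : Set₁ where
  field
    Adj    : Fin n → Fin n → Set
    sym    : ∀ {x y} → Adj x y → Adj y x
    irrefl : ∀ {x} → ¬ Adj x x
    dec    : Decidable Adj
open Graph public

module _ {n : ℕ} (G : Graph n) where

  data WalkIn (P : Fin n → Set) : Fin n → Fin n → Set where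
    here : ∀ {x} → P x → WalkIn P x x
    step : ∀ {x y z} → P x → Adj G x y → WalkIn P y z → WalkIn P x z

  InducedConnected : (Fin n → Set) → Set
  InducedConnected P = ∀ x y → P x → P y → WalkIn P x y

  Connected : Set
  Connected = InducedConnected (λ _ → ⊤)

  record Cycle (l : ℕ) : Set where
    field
      len≥3 : suc l ≥ 3
      vtx   : Fin (suc l) → Fin n
      inj   : Injective _≡_ _≡_ vtx
      edges : ∀ (i : Fin l) → Adj G (vtx (inject₁ i)) (vtx (suc i))
      close : Adj G (vtx (fromℕ l)) (vtx zero)

  CycConsecutive : (l : ℕ) → Fin (suc l) → Fin (suc l) → Set
  CycConsecutive l i j =
    (toℕ j ≡ suc (toℕ i)) ⊎ (toℕ i ≡ suc (toℕ j))
    ⊎ (toℕ i ≡ 0 × toℕ j ≡ l) ⊎ (toℕ j ≡ 0 × toℕ i ≡ l)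

  HasChord : {l : ℕ} → Cycle l → Set
  HasChord {l} C = ∃[ i ] ∃[ j ] (i ≢ j × ¬ CycConsecutive l i j
                                  × Adj G (Cycle.vtx C i) (Cycle.vtx C j))

  Chordal : Set
  Chordal = ∀ (l : ℕ) → suc l ≥ 4 → (C : Cycle l) → HasChord C

  ClawFree : Set
  ClawFree = ∀ (x a b c : Fin n) →
    ¬ (Adj G x a × Adj G x b × Adj G x c
       × a ≢ b × b ≢ c × a ≢ c
       × ¬ Adj G a b × ¬ Adj G b c × ¬ Adj G a c)

  Acyclic : Set
  Acyclic = ∀ (l : ℕ) → ¬ Cycle l

  IsTree : Set
  IsTree = Connected × Acyclic

  IsClique : Subset n → Set
  IsClique S = ∀ x y → x ∈ S → y ∈ S → x ≢ y → Adj G x y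

  IsMaxClique : Subset n → Set
  IsMaxClique S = IsClique S × (∀ T → IsClique T → S ⊆ T → T ≡ S)

-- A clique tree of G: the max cliques are enumerated bijectively by
-- C : Fin m → Subset n, and T is a tree on Fin m (i.e. on 𝓜) such that for
-- every vertex v the set 𝓜_v = {i | v ∈ C i} induces a connected subtree.
record CliqueTree {n : ℕ} (G : Graph n) : Set₁ where
  field
    m        : ℕ
    C        : Fin m → Subset n
    C-inj    : Injective _≡_ _≡_ C
    C-max    : ∀ i → IsMaxClique G (C i)
    C-all    : ∀ S → IsMaxClique G S → ∃[ i ] C i ≡ S
    T        : Graph m
    T-tree   : IsTree T
    T-conn-v : ∀ (v : Fin n) → InducedConnected T (λ i → v ∈ C i)

module _ {n : ℕ} {G : Graph n} (CT : CliqueTree G) where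
  open CliqueTree CT

  -- 𝓜_v = {a₁, b, a₂} (as a set of max cliques)
  MEq3 : Fin n → Fin m → Fin m → Fin m → Set
  MEq3 v a₁ b a₂ = ∀ i → (v ∈ C i → (i ≡ a₁ ⊎ i ≡ b ⊎ i ≡ a₂))
                        × ((i ≡ a₁ ⊎ i ≡ b ⊎ i ≡ a₂) → v ∈ C i)

  ForkTriangle : Fin m → Fin m → Fin m → Fin m → Set
  ForkTriangle b a₁ a₂ a₃ =
    a₁ ≢ a₂ × a₂ ≢ a₃ × a₁ ≢ a₃
    × Adj T b a₁ × Adj T b a₂ × Adj T b a₃
    × (∃[ u ] MEq3 u a₁ b a₂) × (∃[ v ] MEq3 v a₂ b a₃) × (∃[ w ] MEq3 w a₃ b a₁)

  HasForkTriangle : Fin m → Set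
  HasForkTriangle b = ∃[ a₁ ] ∃[ a₂ ] ∃[ a₃ ] ForkTriangle b a₁ a₂ a₃

module Submission where

open import Defs
open import Data.Nat using (ℕ; zero; suc; s≤s; z≤n)
open import Data.Fin using (Fin; zero; suc; inject₁; fromℕ)
open import Data.Fin.Subset using (Subset; _∈_; _∉_; _⊆_; _∪_; ⁅_⁆)
open import Data.Fin.Subset.Properties
  using (_∈?_; x∈⁅x⁆; x∈⁅y⁆⇒x≡y; x∈p∪q⁺; x∈p∪q⁻; ⊆-antisym)
open import Data.Fin.Properties using (_≟_; any?; all?; ¬∀⟶∃¬)
open import Data.Product using (Σ; _×_; ∃-syntax; _,_; proj₁; proj₂)
open import Data.Sum using (_⊎_; inj₁; inj₂; [_,_])
open import Data.Empty using (⊥; ⊥-elim)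
open import Data.List using (List; []; _∷_; allFin)
open import Data.List.Relation.Unary.Any using (here; there)
import Data.List.Membership.Propositional as List
open import Data.List.Membership.Propositional.Properties using (∈-allFin)
open import Relation.Nullary using (¬_; Dec; yes; no)
open import Relation.Nullary.Decidable using (_⊎-dec_; _→-dec_)
open import Relation.Binary.PropositionalEquality
  using (_≡_; _≢_; refl; cong; subst) renaming (sym to ≡-sym; trans to ≡-trans)

twoOfThree : ∀ {A B D : Set} → A ⊎ B → B ⊎ D → D ⊎ A → (A × B) ⊎ (B × D) ⊎ (D × A)
twoOfThree (inj₁ a) (inj₁ b) _        = inj₁ (a , b)
twoOfThree (inj₁ a) (inj₂ d) _        = inj₂ (inj₂ (d , a))
twoOfThree (inj₂ b) _        (inj₁ d) = inj₂ (inj₁ (b , d))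
twoOfThree (inj₂ b) _        (inj₂ a) = inj₁ (a , b)

module Walks {m : ℕ} (H : Graph m) where

  mapWalk : ∀ {P Q : Fin m → Set} → (∀ {i} → P i → Q i) →
            ∀ {x y} → WalkIn H P x y → WalkIn H Q x y
  mapWalk f (here p)     = here (f p)
  mapWalk f (step p a w) = step (f p) a (mapWalk f w)

  infixr 5 _++_
  infixl 4 _▷_

  _++_ : ∀ {P x y z} → WalkIn H P x y → WalkIn H P y z → WalkIn H P x z
  here _     ++ w′ = w′
  step p a w ++ w′ = step p a (w ++ w′)

  endpoint : ∀ {P x y} → WalkIn H P x y → P y
  endpoint (here p)     = p
  endpoint (step _ _ w) = endpoint w

  _▷_ : ∀ {P x y z} → WalkIn H P x y → Adj H y z × P z → WalkIn H P x z
  w ▷ (a , pz) = w ++ step (endpoint w) a (here pz)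

  firstHit : ∀ {P x b} → x ≢ b → WalkIn H P x b →
    Σ (Fin m) λ d → P d × Adj H d b × WalkIn H (λ i → P i × i ≢ b) x d
  firstHit x≢b (here _) = ⊥-elim (x≢b refl)
  firstHit {b = b} x≢b (step {y = y} px a w) with y ≟ b
  ... | yes refl = _ , px , a , here (px , x≢b)
  ... | no y≢b with firstHit y≢b w
  ... | d , pd , ad , w′ = d , pd , ad , step (px , x≢b) a w′

  exitEdge : ∀ {P} (S : Fin m → Set) → (∀ i → Dec (S i)) →
    ∀ {x y} → ¬ S x → S y → WalkIn H P x y →
    Σ (Fin m) λ d → Σ (Fin m) λ s → P d × ¬ S d × S s × Adj H d s
  exitEdge S S? ¬sx sy (here _) = ⊥-elim (¬sx sy)
  exitEdge S S? ¬sx sy (step {y = y} px a w) with S? y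
  ... | yes s  = _ , y , px , ¬sx , s , a
  ... | no ¬s  = exitEdge S S? ¬s sy w

  _◂_ : ∀ {k} → Fin m → (Fin (suc k) → Fin m) → Fin (suc (suc k)) → Fin m
  (x ◂ f) zero    = x
  (x ◂ f) (suc i) = f i

  -- SimplePath P z k f: f lists the k + 1 pairwise distinct vertices of a
  -- path inside P, from f zero to z, consecutive ones adjacent.
  data SimplePath (P : Fin m → Set) (z : Fin m) : (k : ℕ) → (Fin (suc k) → Fin m) → Set where
    end  : P z → SimplePath P z zero (λ _ → z)
    cons : ∀ {k f} x → P x → Adj H x (f zero) → (∀ i → f i ≢ x) →
           SimplePath P z k f → SimplePath P z (suc k) (x ◂ f)

  module _ {P : Fin m → Set} {z : Fin m} where

    pathInside : ∀ {k f} → SimplePath P z k f → ∀ i → P (f i)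
    pathInside (end pz)             i       = pz
    pathInside (cons x px _ _ p)    zero    = px
    pathInside (cons x px _ _ p)    (suc i) = pathInside p i

    pathInjective : ∀ {k f} → SimplePath P z k f → ∀ i j → f i ≡ f j → i ≡ j
    pathInjective (end _)            zero    zero    e = refl
    pathInjective (cons x _ _ fr p)  zero    zero    e = refl
    pathInjective (cons x _ _ fr p)  zero    (suc j) e = ⊥-elim (fr j (≡-sym e))
    pathInjective (cons x _ _ fr p)  (suc i) zero    e = ⊥-elim (fr i e)
    pathInjective (cons x _ _ fr p)  (suc i) (suc j) e = cong suc (pathInjective p i j e)

    pathEnd : ∀ {k f} → SimplePath P z k f → f (fromℕ k) ≡ z
    pathEnd (end _)            = refl
    pathEnd (cons x _ _ _ p)   = pathEnd p

    pathEdge : ∀ {k f} → SimplePath P z k f → ∀ (i : Fin k) → Adj H (f (inject₁ i)) (f (suc i))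
    pathEdge (cons x _ a _ p) zero    = a
    pathEdge (cons x _ _ _ p) (suc i) = pathEdge p i

    SimplePathFrom : Fin m → Set
    SimplePathFrom x = Σ ℕ λ k → Σ (Fin (suc k) → Fin m) λ f → SimplePath P z k f × f zero ≡ x

    pathTail : ∀ {k f} → SimplePath P z k f → ∀ i → SimplePathFrom (f i)
    pathTail (end pz)  zero    = _ , _ , end pz , refl
    pathTail p@(cons _ _ _ _ _) zero = _ , _ , p , refl
    pathTail (cons _ _ _ _ p) (suc i) = pathTail p i

    toSimplePath : ∀ {x} → WalkIn H P x z → SimplePathFrom x
    toSimplePath (here px) = _ , _ , end px , refl
    toSimplePath {x} (step px a w) with toSimplePath w
    ... | k , f , p , f₀≡y with any? (λ i → f i ≟ x)
    ... | yes (i , fi≡x) = subst SimplePathFrom fi≡x (pathTail p i)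
    ... | no x∉f = suc k , x ◂ f ,
          cons x px (subst (Adj H x) (≡-sym f₀≡y) a) (λ i fi≡x → x∉f (i , fi≡x)) p , refl

  -- In an acyclic graph, distinct neighbours d₁, d₂ of k are joined by no
  -- walk avoiding k: such a walk, shortened to a simple path and closed up
  -- through k, would be a cycle.
  noBypass : Acyclic H → ∀ {k d₁ d₂} → Adj H k d₁ → Adj H k d₂ → d₁ ≢ d₂ →
             ¬ WalkIn H (_≢ k) d₁ d₂
  noBypass acyclic {k} kd₁ kd₂ d₁≢d₂ w with toSimplePath w
  ... | zero  , f , p , f₀≡d₁ = d₁≢d₂ (≡-trans (≡-sym f₀≡d₁) (pathEnd p))
  ... | suc l , f , p , f₀≡d₁ = acyclic (suc (suc l)) cycle
    where
    injective : ∀ {i j} → (k ◂ f) i ≡ (k ◂ f) j → i ≡ j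
    injective {zero}  {zero}  e = refl
    injective {zero}  {suc j} e = ⊥-elim (pathInside p j (≡-sym e))
    injective {suc i} {zero}  e = ⊥-elim (pathInside p i e)
    injective {suc i} {suc j} e = cong suc (pathInjective p i j e)

    edges : ∀ (i : Fin (suc (suc l))) → Adj H ((k ◂ f) (inject₁ i)) ((k ◂ f) (suc i))
    edges zero    = subst (Adj H k) (≡-sym f₀≡d₁) kd₁
    edges (suc i) = pathEdge p i

    cycle : Cycle H (suc (suc l))
    cycle = record
      { len≥3 = s≤s (s≤s (s≤s z≤n))
      ; vtx   = k ◂ f
      ; inj   = injective
      ; edges = edges
      ; close = subst (λ v → Adj H v k) (≡-sym (pathEnd p)) (Graph.sym H kd₂)
      }

  noCrossing : Acyclic H → ∀ {k d j} → Adj H k d →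
               WalkIn H (_≢ k) d j → WalkIn H (_≢ d) j k → ⊥
  noCrossing acyclic kd w₁ w₂ with firstHit (endpoint w₁) w₂
  ... | d′ , d′≢d , d′k , w′ =
    noBypass acyclic kd (Graph.sym H d′k) (λ d≡d′ → d′≢d (≡-sym d≡d′)) (w₁ ++ mapWalk proj₂ w′)

module MaximalCliques {n : ℕ} (G : Graph n) where

  -- v cannot be added to the clique S: it is in S already or misses a vertex of S.
  Blocked : Subset n → Fin n → Set
  Blocked S v = v ∈ S ⊎ Σ (Fin n) λ s → s ∈ S × ¬ Adj G v s

  blocked-⊆ : ∀ {S S′} → S ⊆ S′ → ∀ {v} → Blocked S v → Blocked S′ v
  blocked-⊆ S⊆S′ (inj₁ v∈S)           = inj₁ (S⊆S′ v∈S)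
  blocked-⊆ S⊆S′ (inj₂ (s , s∈S , ¬a)) = inj₂ (s , S⊆S′ s∈S , ¬a)

  block : (S : Subset n) → IsClique G S → (v : Fin n) →
          Σ (Subset n) λ S′ → IsClique G S′ × S ⊆ S′ × Blocked S′ v
  block S clique v with v ∈? S
  ... | yes v∈S = S , clique , (λ x → x) , inj₁ v∈S
  ... | no v∉S with all? (λ s → (s ∈? S) →-dec dec G v s)
  ... | yes v~S = S ∪ ⁅ v ⁆ , clique′ , (λ x → x∈p∪q⁺ (inj₁ x)) , inj₁ (x∈p∪q⁺ (inj₂ (x∈⁅x⁆ v)))
    where
    member : ∀ {x} → x ∈ S ∪ ⁅ v ⁆ → x ∈ S ⊎ x ≡ v
    member {x} x∈ with x∈p∪q⁻ S ⁅ v ⁆ x∈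
    ... | inj₁ x∈S = inj₁ x∈S
    ... | inj₂ x∈v = inj₂ (x∈⁅y⁆⇒x≡y v x∈v)
    clique′ : IsClique G (S ∪ ⁅ v ⁆)
    clique′ x y x∈ y∈ x≢y with member x∈ | member y∈
    ... | inj₁ x∈S  | inj₁ y∈S  = clique x y x∈S y∈S x≢y
    ... | inj₁ x∈S  | inj₂ refl = Graph.sym G (v~S x x∈S)
    ... | inj₂ refl | inj₁ y∈S  = v~S y y∈S
    ... | inj₂ refl | inj₂ refl = ⊥-elim (x≢y refl)
  ... | no ¬v~S with ¬∀⟶∃¬ n _ (λ s → (s ∈? S) →-dec dec G v s) ¬v~S
  ... | s , ¬v~s with s ∈? S
  ... | yes s∈S = S , clique , (λ x → x) , inj₂ (s , s∈S , λ a → ¬v~s (λ _ → a))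
  ... | no s∉S  = ⊥-elim (¬v~s (λ s∈S → ⊥-elim (s∉S s∈S)))

  saturate : (S : Subset n) → IsClique G S → (vs : List (Fin n)) →
    Σ (Subset n) λ S′ → IsClique G S′ × S ⊆ S′ × (∀ {v} → v List.∈ vs → Blocked S′ v)
  saturate S clique [] = S , clique , (λ x → x) , λ ()
  saturate S clique (v ∷ vs) with block S clique v
  ... | S₁ , clique₁ , S⊆S₁ , blocked-v with saturate S₁ clique₁ vs
  ... | S′ , clique′ , S₁⊆S′ , blocked-vs =
    S′ , clique′ , (λ x → S₁⊆S′ (S⊆S₁ x)) , blocked
    where
    blocked : ∀ {u} → u List.∈ (v ∷ vs) → Blocked S′ u
    blocked (here refl) = blocked-⊆ S₁⊆S′ blocked-v
    blocked (there u∈)  = blocked-vs u∈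

  saturatedIsMaximal : ∀ S → IsClique G S → (∀ v → Blocked S v) → IsMaxClique G S
  saturatedIsMaximal S clique blocked = clique , maximal
    where
    maximal : ∀ T → IsClique G T → S ⊆ T → T ≡ S
    maximal T cliqueT S⊆T = ⊆-antisym T⊆S S⊆T
      where
      T⊆S : T ⊆ S
      T⊆S {v} v∈T with v ∈? S | blocked v
      ... | yes v∈S | _                       = v∈S
      ... | no v∉S  | inj₁ v∈S                = ⊥-elim (v∉S v∈S)
      ... | no v∉S  | inj₂ (s , s∈S , ¬v~s)   =
        ⊥-elim (¬v~s (cliqueT v s v∈T (S⊆T s∈S) (λ v≡s → v∉S (subst (_∈ S) (≡-sym v≡s) s∈S))))

  edgeInMaxClique : ∀ {x y} → Adj G x y → Σ (Subset n) λ S → IsMaxClique G S × x ∈ S × y ∈ S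
  edgeInMaxClique {x} {y} x~y with saturate (⁅ x ⁆ ∪ ⁅ y ⁆) edge (allFin n)
    where
    member : ∀ {v} → v ∈ ⁅ x ⁆ ∪ ⁅ y ⁆ → v ≡ x ⊎ v ≡ y
    member {v} v∈ with x∈p∪q⁻ ⁅ x ⁆ ⁅ y ⁆ v∈
    ... | inj₁ v∈x = inj₁ (x∈⁅y⁆⇒x≡y x v∈x)
    ... | inj₂ v∈y = inj₂ (x∈⁅y⁆⇒x≡y y v∈y)
    edge : IsClique G (⁅ x ⁆ ∪ ⁅ y ⁆)
    edge p q p∈ q∈ p≢q with member p∈ | member q∈
    ... | inj₁ refl | inj₁ refl = ⊥-elim (p≢q refl)
    ... | inj₁ refl | inj₂ refl = x~y
    ... | inj₂ refl | inj₁ refl = Graph.sym G x~y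
    ... | inj₂ refl | inj₂ refl = ⊥-elim (p≢q refl)
  ... | S , clique , ⊆S , blocked =
    S , saturatedIsMaximal S clique (λ v → blocked (∈-allFin v)) ,
    ⊆S (x∈p∪q⁺ (inj₁ (x∈⁅x⁆ x))) , ⊆S (x∈p∪q⁺ (inj₂ (x∈⁅x⁆ y)))

module Separation {n : ℕ} {G : Graph n} (CT : CliqueTree G) where
  open CliqueTree CT
  open Walks T public
  open MaximalCliques G

  acyclic : Acyclic T
  acyclic = proj₂ T-tree

  neighbour≢ : ∀ {b a} → Adj T b a → a ≢ b
  neighbour≢ ba a≡b = Graph.irrefl T (subst (Adj T _) a≡b ba)

  ≢-by-clique : ∀ {x y i} → x ∈ C i → y ∉ C i → x ≢ y
  ≢-by-clique {i = i} x∈ y∉ x≡y = y∉ (subst (_∈ C i) x≡y x∈)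

  cliqueAdj : ∀ {x y i} → x ∈ C i → y ∈ C i → x ≢ y → Adj G x y
  cliqueAdj {x} {y} {i} x∈ y∈ x≢y = proj₁ (C-max i) x y x∈ y∈ x≢y

  sharedClique : ∀ {x y} → Adj G x y → Σ (Fin m) λ j → x ∈ C j × y ∈ C j
  sharedClique x~y with edgeInMaxClique x~y
  ... | S , maxS , x∈S , y∈S with C-all S maxS
  ... | j , Cj≡S = j , subst (_ ∈_) (≡-sym Cj≡S) x∈S , subst (_ ∈_) (≡-sym Cj≡S) y∈S

  -- Adjacent nodes of the clique tree are distinct max cliques, so the
  -- second one has a vertex missing from the first.
  privateVertex : ∀ {a d} → Adj T a d → Σ (Fin n) λ x → x ∈ C d × x ∉ C a
  privateVertex {a} {d} ad with all? (λ x → (x ∈? C d) →-dec (x ∈? C a))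
  ... | yes Cd⊆Ca =
    ⊥-elim (neighbour≢ ad (≡-sym (C-inj (proj₂ (C-max d) (C a) (proj₁ (C-max a)) (λ {x} → Cd⊆Ca x)))))
  ... | no Cd⊈Ca with ¬∀⟶∃¬ n _ (λ x → (x ∈? C d) →-dec (x ∈? C a)) Cd⊈Ca
  ... | x , ¬x∈d⇒x∈a with x ∈? C d
  ... | yes x∈d = x , x∈d , λ x∈a → ¬x∈d⇒x∈a (λ _ → x∈a)
  ... | no x∉d  = ⊥-elim (¬x∈d⇒x∈a (λ x∈d → ⊥-elim (x∉d x∈d)))

  -- The cliques of x form a subtree, so they are connected avoiding any clique
  -- not containing x.
  avoidingWalk : ∀ {x k i j} → x ∉ C k → x ∈ C i → x ∈ C j → WalkIn T (_≢ k) i j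
  avoidingWalk {x} {i = i} {j} x∉k x∈i x∈j =
    mapWalk (λ x∈ i≡k → x∉k (subst (λ l → x ∈ C l) i≡k x∈)) (T-conn-v x i j x∈i x∈j)

  NoCommon : Fin n → Fin n → Set
  NoCommon x y = ∀ j → x ∈ C j → y ∈ C j → ⊥

  noCommon⇒≢ : ∀ {x y i} → x ∈ C i → NoCommon x y → x ≢ y
  noCommon⇒≢ {i = i} x∈ nc x≡y = nc i x∈ (subst (_∈ C i) x≡y x∈)

  noCommon⇒¬Adj : ∀ {x y} → NoCommon x y → ¬ Adj G x y
  noCommon⇒¬Adj nc x~y with sharedClique x~y
  ... | j , x∈ , y∈ = nc j x∈ y∈

  notInSibling : ∀ {k d₁ d₂ x} → Adj T k d₁ → Adj T k d₂ → d₁ ≢ d₂ →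
                 x ∉ C k → x ∈ C d₁ → x ∉ C d₂
  notInSibling kd₁ kd₂ d₁≢d₂ x∉k x∈d₁ x∈d₂ =
    noBypass acyclic kd₁ kd₂ d₁≢d₂ (avoidingWalk x∉k x∈d₁ x∈d₂)

  siblingsApart : ∀ {k d₁ d₂ x y} → Adj T k d₁ → Adj T k d₂ → d₁ ≢ d₂ →
    x ∉ C k → x ∈ C d₁ → y ∉ C k → y ∈ C d₂ → NoCommon x y
  siblingsApart kd₁ kd₂ d₁≢d₂ x∉k x∈d₁ y∉k y∈d₂ j x∈j y∈j =
    noBypass acyclic kd₁ kd₂ d₁≢d₂ (avoidingWalk x∉k x∈d₁ x∈j ++ avoidingWalk y∉k y∈j y∈d₂)

  acrossEdgeApart : ∀ {k d x y} → Adj T k d →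
    x ∉ C k → x ∈ C d → y ∈ C k → y ∉ C d → NoCommon x y
  acrossEdgeApart kd x∉k x∈d y∈k y∉d j x∈j y∈j =
    noCrossing acyclic kd (avoidingWalk x∉k x∈d x∈j) (avoidingWalk y∉d y∈j y∈k)

module ForkAnalysis {n : ℕ} (G : Graph n) (clawFree : ClawFree G) (CT : CliqueTree G) where
  open CliqueTree CT
  open Separation CT

  noClaw : ∀ z x y w → Adj G z x → Adj G z y → Adj G z w →
    NoCommon x y → NoCommon y w → NoCommon x w → ∀ {i j} → x ∈ C i → y ∈ C j → ⊥
  noClaw z x y w z~x z~y z~w xy yw xw x∈ y∈ =
    clawFree z x y w
      ( z~x , z~y , z~w
      , noCommon⇒≢ x∈ xy , noCommon⇒≢ y∈ yw , noCommon⇒≢ x∈ xw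
      , noCommon⇒¬Adj xy , noCommon⇒¬Adj yw , noCommon⇒¬Adj xw)

  -- z ∈ C b lies in at most two of the tree-neighbours of b: otherwise
  -- private vertices of three of them are the leaves of a claw at z.
  notInThreeNeighbours : ∀ {z b p q r} → z ∈ C b →
    Adj T b p → Adj T b q → Adj T b r → p ≢ q → q ≢ r → p ≢ r →
    z ∈ C p → z ∈ C q → z ∈ C r → ⊥
  notInThreeNeighbours {z} z∈b bp bq br p≢q q≢r p≢r z∈p z∈q z∈r
    with privateVertex bp | privateVertex bq | privateVertex br
  ... | x , x∈p , x∉b | y , y∈q , y∉b | w , w∈r , w∉b =
    noClaw z x y w
      (cliqueAdj z∈p x∈p (≢-by-clique z∈b x∉b))
      (cliqueAdj z∈q y∈q (≢-by-clique z∈b y∉b))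
      (cliqueAdj z∈r w∈r (≢-by-clique z∈b w∉b))
      (siblingsApart bp bq p≢q x∉b x∈p y∉b y∈q)
      (siblingsApart bq br q≢r y∉b y∈q w∉b w∈r)
      (siblingsApart bp br p≢r x∉b x∈p w∉b w∈r)
      x∈p y∈q

  -- If 𝓜_t = {p, b, q}, then z ∈ C b lies in C p or C q: otherwise t is the
  -- centre of a claw with z and private vertices of p and q.
  inOneOfPair : ∀ {z b p q t} → z ∈ C b → Adj T b p → Adj T b q → p ≢ q →
    MEq3 CT t p b q → z ∈ C p ⊎ z ∈ C q
  inOneOfPair {z} {b} {p} {q} {t} z∈b bp bq p≢q 𝓜t with z ∈? C p | z ∈? C q
  ... | yes z∈p | _       = inj₁ z∈p
  ... | no _    | yes z∈q = inj₂ z∈q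
  ... | no z∉p  | no z∉q with privateVertex bp | privateVertex bq
  ... | x , x∈p , x∉b | y , y∈q , y∉b =
    ⊥-elim (noClaw t x y z
      (cliqueAdj t∈p x∈p (≢-by-clique t∈b x∉b))
      (cliqueAdj t∈q y∈q (≢-by-clique t∈b y∉b))
      (cliqueAdj t∈b z∈b (≢-by-clique t∈p z∉p))
      (siblingsApart bp bq p≢q x∉b x∈p y∉b y∈q)
      (acrossEdgeApart bq y∉b y∈q z∈b z∉q)
      (acrossEdgeApart bp x∉b x∈p z∈b z∉p)
      x∈p y∈q)
    where
    t∈p = proj₂ (𝓜t p) (inj₁ refl)
    t∈b = proj₂ (𝓜t b) (inj₂ (inj₁ refl))
    t∈q = proj₂ (𝓜t q) (inj₂ (inj₂ refl))

  -- If z ∈ C p ∩ C b ∩ C q and 𝓜_t = {r, b, p}, the subtree 𝓜_z does not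
  -- continue past p to a further neighbour d: a private vertex of d (w.r.t. p),
  -- a private vertex of q (w.r.t. b) and t would be the leaves of a claw at z.
  noExtensionPast : ∀ {z b p q r t d} → Adj T b p → Adj T b q → Adj T b r → p ≢ q → q ≢ r →
    z ∈ C p → z ∈ C q → z ∈ C b → MEq3 CT t r b p → Adj T p d → d ≢ b → z ∈ C d → ⊥
  noExtensionPast {z} {b} {p} {q} {r} {t} {d} bp bq br p≢q q≢r z∈p z∈q z∈b 𝓜t pd d≢b z∈d
    with privateVertex pd | privateVertex bq
  ... | y , y∈d , y∉p | x , x∈q , x∉b =
    noClaw z y x t
      (cliqueAdj z∈d y∈d (≢-by-clique z∈p y∉p))
      (cliqueAdj z∈q x∈q (≢-by-clique z∈b x∉b))
      (cliqueAdj z∈b t∈b (≢-by-clique z∈q t∉q))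
      y≁x (acrossEdgeApart bq x∉b x∈q t∈b t∉q) y≁t y∈d x∈q
    where
    t∈b = proj₂ (𝓜t b) (inj₂ (inj₁ refl))
    t∉q : t ∉ C q
    t∉q t∈q with proj₁ (𝓜t q) t∈q
    ... | inj₁ q≡r        = q≢r q≡r
    ... | inj₂ (inj₁ q≡b) = neighbour≢ bq q≡b
    ... | inj₂ (inj₂ q≡p) = p≢q (≡-sym q≡p)
    b≢p : b ≢ p
    b≢p b≡p = neighbour≢ bp (≡-sym b≡p)
    bypass : ¬ WalkIn T (_≢ p) d b
    bypass = noBypass acyclic pd (Graph.sym T bp) d≢b
    y≁x : NoCommon y x
    y≁x j y∈j x∈j = bypass
      (avoidingWalk y∉p y∈d y∈j
        ++ avoidingWalk (notInSibling bq bp (λ q≡p → p≢q (≡-sym q≡p)) x∉b x∈q) x∈j x∈q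
        ▷ (Graph.sym T bq , b≢p))
    y≁t : NoCommon y t
    y≁t j y∈j t∈j with proj₁ (𝓜t j) t∈j
    ... | inj₁ refl        = bypass (avoidingWalk y∉p y∈d y∈j ▷ (Graph.sym T br , b≢p))
    ... | inj₂ (inj₁ refl) = bypass (avoidingWalk y∉p y∈d y∈j)
    ... | inj₂ (inj₂ refl) = y∉p y∈j

  -- If z ∈ C p ∩ C b ∩ C q for neighbours p ≠ q of b, and a third neighbour r
  -- forms fork-triangle sides {r, b, p} and {r, b, q}, then 𝓜_z = {p, b, q}:
  -- the subtree 𝓜_z cannot leave {p, b, q} through b (three neighbours) nor
  -- through p or q (noExtensionPast).
  cliquesOfMiddle : ∀ {z b p q r t t′} → Adj T b p → Adj T b q → Adj T b r →
    p ≢ q → q ≢ r → p ≢ r → z ∈ C b → z ∈ C p → z ∈ C q →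
    MEq3 CT t r b p → MEq3 CT t′ r b q → MEq3 CT z p b q
  cliquesOfMiddle {z} {b} {p} {q} bp bq br p≢q q≢r p≢r z∈b z∈p z∈q 𝓜t 𝓜t′ i = only , all
    where
    S : Fin m → Set
    S j = j ≡ p ⊎ j ≡ b ⊎ j ≡ q
    S? : ∀ j → Dec (S j)
    S? j = (j ≟ p) ⊎-dec (j ≟ b) ⊎-dec (j ≟ q)
    all : S i → z ∈ C i
    all (inj₁ refl)        = z∈p
    all (inj₂ (inj₁ refl)) = z∈b
    all (inj₂ (inj₂ refl)) = z∈q
    only : z ∈ C i → S i
    only z∈i with S? i
    ... | yes i∈S = i∈S
    ... | no i∉S with exitEdge S S? i∉S (inj₂ (inj₁ refl)) (T-conn-v z i b z∈i z∈b)
    ... | d , _ , z∈d , d∉S , inj₁ refl , dp = ⊥-elim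
      (noExtensionPast bp bq br p≢q q≢r z∈p z∈q z∈b 𝓜t (Graph.sym T dp) (λ d≡b → d∉S (inj₂ (inj₁ d≡b))) z∈d)
    ... | d , _ , z∈d , d∉S , inj₂ (inj₁ refl) , db = ⊥-elim
      (notInThreeNeighbours z∈b bp bq (Graph.sym T db) p≢q
        (λ q≡d → d∉S (inj₂ (inj₂ (≡-sym q≡d)))) (λ p≡d → d∉S (inj₁ (≡-sym p≡d))) z∈p z∈q z∈d)
    ... | d , _ , z∈d , d∉S , inj₂ (inj₂ refl) , dq = ⊥-elim
      (noExtensionPast bq bp br (λ q≡p → p≢q (≡-sym q≡p)) p≢r z∈q z∈p z∈b 𝓜t′ (Graph.sym T dq)
        (λ d≡b → d∉S (inj₂ (inj₁ d≡b))) z∈d)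

  reverseMEq3 : ∀ {t p b q} → MEq3 CT t p b q → MEq3 CT t q b p
  reverseMEq3 𝓜t i = (λ t∈ → reverse (proj₁ (𝓜t i) t∈)) , (λ i∈ → proj₂ (𝓜t i) (reverse i∈))
    where
    reverse : ∀ {A B D : Set} → A ⊎ B ⊎ D → D ⊎ B ⊎ A
    reverse (inj₁ a)        = inj₂ (inj₂ a)
    reverse (inj₂ (inj₁ b)) = inj₂ (inj₁ b)
    reverse (inj₂ (inj₂ d)) = inj₁ d

  rotate : ∀ {b a₁ a₂ a₃} → ForkTriangle CT b a₁ a₂ a₃ → ForkTriangle CT b a₂ a₃ a₁
  rotate (a₁≢a₂ , a₂≢a₃ , a₁≢a₃ , ba₁ , ba₂ , ba₃ , u , v , w) =
    a₂≢a₃ , (λ a₃≡a₁ → a₁≢a₃ (≡-sym a₃≡a₁)) , (λ a₂≡a₁ → a₁≢a₂ (≡-sym a₂≡a₁)) ,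
    ba₂ , ba₃ , ba₁ , v , w , u

  CentredAt : Fin n → Fin m → Set
  CentredAt z b = ∃[ a ] ∃[ c ] (a ≢ c × a ≢ b × c ≢ b × MEq3 CT z a b c × Adj T b a × Adj T b c)

  inTwoOfFork : ∀ {z b a₁ a₂ a₃} → z ∈ C b → ForkTriangle CT b a₁ a₂ a₃ →
    (z ∈ C a₁ × z ∈ C a₂) ⊎ (z ∈ C a₂ × z ∈ C a₃) ⊎ (z ∈ C a₃ × z ∈ C a₁)
  inTwoOfFork z∈b (a₁≢a₂ , a₂≢a₃ , a₁≢a₃ , ba₁ , ba₂ , ba₃ , (_ , 𝓜u) , (_ , 𝓜v) , (_ , 𝓜w)) =
    twoOfThree (inOneOfPair z∈b ba₁ ba₂ a₁≢a₂ 𝓜u)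
               (inOneOfPair z∈b ba₂ ba₃ a₂≢a₃ 𝓜v)
               (inOneOfPair z∈b ba₃ ba₁ (λ a₃≡a₁ → a₁≢a₃ (≡-sym a₃≡a₁)) 𝓜w)

  centredAtFork : ∀ {z b a₁ a₂ a₃} → ForkTriangle CT b a₁ a₂ a₃ →
    z ∈ C b → z ∈ C a₁ → z ∈ C a₂ → CentredAt z b
  centredAtFork {a₁ = a₁} {a₂} (a₁≢a₂ , a₂≢a₃ , a₁≢a₃ , ba₁ , ba₂ , ba₃ , _ , (_ , 𝓜v) , (_ , 𝓜w))
    z∈b z∈a₁ z∈a₂ =
    a₁ , a₂ , a₁≢a₂ , neighbour≢ ba₁ , neighbour≢ ba₂ ,
    cliquesOfMiddle ba₁ ba₂ ba₃ a₁≢a₂ a₂≢a₃ a₁≢a₃ z∈b z∈a₁ z∈a₂ 𝓜w (reverseMEq3 𝓜v) ,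
    ba₁ , ba₂

-- Lemma 3.11.  z lies in two of the fork cliques; rotating the fork triangle
-- makes them its first two cliques, which together with b are all of 𝓜_z.
lemma3p11 : ∀ {n : ℕ} (G : Graph n) → Connected G → Chordal G → ClawFree G →
    (CT : CliqueTree G) → (z : Fin n) → (b : Fin (CliqueTree.m CT)) →
    z ∈ CliqueTree.C CT b → HasForkTriangle CT b →
    ∃[ a ] ∃[ c ] (a ≢ c × a ≢ b × c ≢ b × MEq3 CT z a b c
    × Adj (CliqueTree.T CT) b a × Adj (CliqueTree.T CT) b c)
lemma3p11 G _ _ clawFree CT z b z∈b (_ , _ , _ , fork) =
  [ (λ (z∈a₁ , z∈a₂) → centredAtFork fork z∈b z∈a₁ z∈a₂)
  , [ (λ (z∈a₂ , z∈a₃) → centredAtFork (rotate fork) z∈b z∈a₂ z∈a₃)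
    , (λ (z∈a₃ , z∈a₁) → centredAtFork (rotate (rotate fork)) z∈b z∈a₃ z∈a₁)
    ]
  ] (inTwoOfFork z∈b fork)
  where open ForkAnalysis G clawFree CT
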